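{- Let $(L;\vee,\wedge,^{\Delta},0,1)$ be a weakly complemented lattice whose underlying lattice is distributive. For an S-filter $F$ of $L$ let $\theta_F=\{(x,y)\in L^2\mid \exists u\in F,\ x\vee u^{\Delta}=y\vee u^{\Delta}\}$. Then for any two S-filters $F_1,F_2$ of $L$, $\theta_{F_1}\circ\theta_{F_2}=\theta_{F_2}\circ\theta_{F_1}$ (relational product).
   Context: A weakly complemented lattice (WCL) is an algebra $(L;\vee,\wedge,^{\Delta},0,1)$ such that $(L;\wedge,\vee,0,1)$ is a bounded lattice and, for all $x,y\in L$: $x^{\Delta\Delta}\le x$; $x\le y\Rightarrow y^{\Delta}\le x^{\Delta}$; $(x\wedge y)\vee(x\wedge y^{\Delta})=x$. A filter is a nonempty upward closed subset closed under $\wedge$. With $x\,\overline{\sqcap}\,y=(x^{\Delta}\vee y^{\Delta})^{\Delta}$, an S-filter is a filter $F$ with $x\,\overline{\sqcap}\,y\in F$ whenever $x,y\in F$. The relational product is $\alpha\circ\beta=\{(x,y)\mid \exists z,\ (x,z)\in\alpha,\ (z,y)\in\beta\}$. -}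

module Defs where

open import Level using (Level; _⊔_) renaming (suc to lsuc)
open import Data.Product using (Σ; ∃; _×_; _,_)
open import Relation.Binary.Core using (Rel)
open import Algebra.Lattice.Bundles using (DistributiveLattice)

record DistributiveWCL (c ℓ : Level) : Set (lsuc (c ⊔ ℓ)) where
  field
    distLattice : DistributiveLattice c ℓ
  open DistributiveLattice distLattice public
  infix 4 _≤_
  _≤_ : Rel Carrier ℓ
  x ≤ y = (x ∧ y) ≈ x
  field
    ⊥ ⊤     : Carrier
    ⊥-least : ∀ x → ⊥ ≤ x
    ⊤-great : ∀ x → x ≤ ⊤
    Δ       : Carrier → Carrier
    Δ-cong  : ∀ {x y} → x ≈ y → Δ x ≈ Δ y
    ΔΔ≤     : ∀ x → Δ (Δ x) ≤ x
    Δ-anti  : ∀ {x y} → x ≤ y → Δ y ≤ Δ x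
    split   : ∀ x y → ((x ∧ y) ∨ (x ∧ Δ y)) ≈ x

module _ {c ℓ : Level} (L : DistributiveWCL c ℓ) where
  open DistributiveWCL L

  _⊓̄_ : Carrier → Carrier → Carrier
  x ⊓̄ y = Δ (Δ x ∨ Δ y)

  record IsFilter {p} (F : Carrier → Set p) : Set (c ⊔ ℓ ⊔ p) where
    field
      nonempty : Σ Carrier F
      up       : ∀ {x y} → x ≤ y → F x → F y
      ∧-closed : ∀ {x y} → F x → F y → F (x ∧ y)

  record IsSFilter {p} (F : Carrier → Set p) : Set (c ⊔ ℓ ⊔ p) where
    field
      isFilter : IsFilter F
      ⊓̄-closed : ∀ {x y} → F x → F y → F (x ⊓̄ y)

  θ : ∀ {p} → (Carrier → Set p) → Carrier → Carrier → Set (c ⊔ ℓ ⊔ p)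
  θ F x y = Σ Carrier λ u → F u × ((x ∨ Δ u) ≈ (y ∨ Δ u))

_∘ᵣ_ : ∀ {a r s} {A : Set a} → (A → A → Set r) → (A → A → Set s) → A → A → Set (a ⊔ r ⊔ s)
(α ∘ᵣ β) x y = Σ _ λ z → α x z × β z y

{-# OPTIONS --safe #-}
-- Write x ≈[ a ] y for x ∨ a ≈ y ∨ a, so that x θ_F y means x ≈[ u^Δ ] y for some u ∈ F.
-- If x ≈[ a ] z ≈[ b ] y in a distributive lattice, then both x ∨ b ∨ a and y ∨ a ∨ b
-- equal z ∨ a ∨ b, and distributivity shows that w = (x ∨ b) ∧ (y ∨ a) satisfies
-- x ≈[ b ] w ≈[ a ] y.  Taking a = u^Δ and b = v^Δ swaps the two factors of the product.
module Submission where

open import Defs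
open import Data.Product using (Σ; _×_; _,_)
open import Algebra.Bundles using (CommutativeBand)
open import Algebra.Lattice.Bundles using (DistributiveLattice)
import Algebra.Lattice.Properties.Lattice as LatticeProperties
import Algebra.Properties.CommutativeSemigroup as CommutativeSemigroupProperties
import Relation.Binary.Reasoning.Setoid as SetoidReasoning

module JoinCongruence {c ℓ} (D : DistributiveLattice c ℓ) where
  open DistributiveLattice D
  open LatticeProperties lattice using (∨-idem; ∨-isSemilattice)
  private
    ∨-band : CommutativeBand c ℓ
    ∨-band = record { isCommutativeBand = ∨-isSemilattice }
  open CommutativeSemigroupProperties (CommutativeBand.commutativeSemigroup ∨-band)
    using (xy∙z≈xz∙y)
  open SetoidReasoning setoid

  infix 4 _≈[_]_
  _≈[_]_ : Carrier → Carrier → Carrier → Set ℓ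
  x ≈[ a ] y = x ∨ a ≈ y ∨ a

  x∨a∨a≈x∨a : ∀ x a → (x ∨ a) ∨ a ≈ x ∨ a
  x∨a∨a≈x∨a x a = begin
    (x ∨ a) ∨ a ≈⟨ ∨-assoc x a a ⟩
    x ∨ (a ∨ a) ≈⟨ ∨-congˡ (∨-idem a) ⟩
    x ∨ a       ∎

  ≈[]-trans-∨ : ∀ {a b x y z} → x ≈[ a ] z → z ≈[ b ] y → (x ∨ b) ∨ a ≈ (y ∨ a) ∨ b
  ≈[]-trans-∨ {a} {b} {x} {y} {z} x≈z z≈y = begin
    (x ∨ b) ∨ a ≈⟨ xy∙z≈xz∙y x b a ⟩
    (x ∨ a) ∨ b ≈⟨ ∨-congʳ x≈z ⟩
    (z ∨ a) ∨ b ≈⟨ xy∙z≈xz∙y z a b ⟩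
    (z ∨ b) ∨ a ≈⟨ ∨-congʳ z≈y ⟩
    (y ∨ b) ∨ a ≈⟨ xy∙z≈xz∙y y b a ⟩
    (y ∨ a) ∨ b ∎

  ∧-≈[]ˡ : ∀ {a b x y} → (x ∨ b) ∨ a ≈ (y ∨ a) ∨ b → (x ∨ b) ∧ (y ∨ a) ≈[ b ] x
  ∧-≈[]ˡ {a} {b} {x} {y} eq = begin
    ((x ∨ b) ∧ (y ∨ a)) ∨ b             ≈⟨ ∨-distribʳ-∧ b (x ∨ b) (y ∨ a) ⟩
    ((x ∨ b) ∨ b) ∧ ((y ∨ a) ∨ b)       ≈⟨ ∧-cong (x∨a∨a≈x∨a x b) (sym eq) ⟩
    (x ∨ b) ∧ ((x ∨ b) ∨ a)             ≈⟨ ∧-absorbs-∨ (x ∨ b) a ⟩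
    x ∨ b                               ∎

  ≈[]-commute : ∀ {a b x y z} → x ≈[ a ] z → z ≈[ b ] y →
                Σ Carrier λ w → x ≈[ b ] w × w ≈[ a ] y
  ≈[]-commute {a} {b} {x} {y} x≈z z≈y =
    (x ∨ b) ∧ (y ∨ a) , sym (∧-≈[]ˡ chain) , w≈y
    where
    chain : (x ∨ b) ∨ a ≈ (y ∨ a) ∨ b
    chain = ≈[]-trans-∨ x≈z z≈y
    w≈y : (x ∨ b) ∧ (y ∨ a) ≈[ a ] y
    w≈y = begin
      ((x ∨ b) ∧ (y ∨ a)) ∨ a ≈⟨ ∨-congʳ (∧-comm (x ∨ b) (y ∨ a)) ⟩
      ((y ∨ a) ∧ (x ∨ b)) ∨ a ≈⟨ ∧-≈[]ˡ (sym chain) ⟩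
      y ∨ a                   ∎

θ-∘-swap : ∀ {c ℓ p} (L : DistributiveWCL c ℓ) (F G : DistributiveWCL.Carrier L → Set p) →
           ∀ x y → (θ L F ∘ᵣ θ L G) x y → (θ L G ∘ᵣ θ L F) x y
θ-∘-swap L F G x y (z , (u , Fu , x≈z) , (v , Gv , z≈y))
  with w , x≈w , w≈y ← JoinCongruence.≈[]-commute (DistributiveWCL.distLattice L) x≈z z≈y
  = w , (v , Gv , x≈w) , (u , Fu , w≈y)

theorem6p5 : ∀ {c ℓ p} (L : DistributiveWCL c ℓ) (F₁ F₂ : DistributiveWCL.Carrier L → Set p) →
    IsSFilter L F₁ → IsSFilter L F₂ →
    (∀ x y → (θ L F₁ ∘ᵣ θ L F₂) x y → (θ L F₂ ∘ᵣ θ L F₁) x y) ×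
    (∀ x y → (θ L F₂ ∘ᵣ θ L F₁) x y → (θ L F₁ ∘ᵣ θ L F₂) x y)
theorem6p5 L F₁ F₂ _ _ = θ-∘-swap L F₁ F₂ , θ-∘-swap L F₂ F₁
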